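{- Let $G$ be a finite group, $\alpha$ an involutory automorphism of $G$, $S=\{s_1,\dots,s_r\}$ a nonempty generalized Cayley subset of $G$ induced by $\alpha$ (with $s_1,\dots,s_r$ distinct), and $X$ a subset of $G$. The following are equivalent: (i) $X$ is a perfect code of $GC(G,S,\alpha)$; (ii) $\{X,\alpha(X)s_1,\dots,\alpha(X)s_r\}$ is a partition of $G$; (iii) $|G|=|X|(r+1)$, $\alpha(X^{ -1})X\cap S=\emptyset$ and $\alpha(X^{ -1})\alpha(X)\cap SS^{ -1}=\{e\}$.
   Context: $G$ is a finite group with identity $e$, and $\alpha$ is an involutory automorphism of $G$ ($\alpha\in\mathrm{Aut}(G)$, $\alpha^2=\mathrm{id}\neq\alpha$). Set $\omega_\alpha(G)=\{\alpha(g^{ -1})g\mid g\in G\}$. A subset $S\subseteq G$ is a generalized Cayley subset of $G$ induced by $\alpha$ if $S\cap\omega_\alpha(G)=\emptyset$ and $\alpha(S)=S^{ -1}$. The generalized Cayley graph $GC(G,S,\alpha)$ has vertex set $G$ and edge set $\{\{g,h\}\mid \alpha(g^{ -1})h\in S\}$. A subset $C$ of the vertex set of a graph is a perfect code if $C$ is independent and every vertex outside $C$ is adjacent to exactly one vertex of $C$. For subsets $A,B\subseteq G$ and $s\in G$: $\alpha(A)=\{\alpha(a)\mid a\in A\}$, $A^{ -1}=\{a^{ -1}\mid a\in A\}$, $AB=\{ab\mid a\in A,b\in B\}$, $As=\{as\mid a\in A\}$. -}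

module Defs where

open import Level using (0ℓ)
open import Data.Nat using (ℕ; suc)
open import Data.Fin using (Fin; zero; suc)
open import Data.Fin.Subset using (Subset; _∈_)
open import Data.Product using (Σ; ∃; ∃-syntax; _×_; _,_)
open import Data.Sum using (_⊎_)
open import Relation.Nullary using (¬_)
open import Relation.Binary.PropositionalEquality using (_≡_; _≢_)
open import Relation.Unary using (Pred)
open import Algebra.Structures using (IsGroup)
open import Algebra.Bundles.Raw using (RawGroup)
open import Algebra.Morphism.Structures using (module GroupMorphisms)

-- A finite group of order n, represented (up to isomorphism) on the
-- carrier Fin n with propositional equality.
record FinGroup (n : ℕ) : Set where
  infixl 7 _∙_
  infix  8 _⁻¹
  field
    _∙_     : Fin n → Fin n → Fin n
    ε       : Fin n
    _⁻¹     : Fin n → Fin n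
    isGroup : IsGroup _≡_ _∙_ ε _⁻¹

  rawGroup : RawGroup 0ℓ 0ℓ
  rawGroup = record { Carrier = Fin n ; _≈_ = _≡_ ; _∙_ = _∙_ ; ε = ε ; _⁻¹ = _⁻¹ }

module _ {n : ℕ} (G : FinGroup n) where
  open FinGroup G
  open GroupMorphisms rawGroup rawGroup

  record IsInvolutoryAutomorphism (α : Fin n → Fin n) : Set where
    field
      isAutomorphism : IsGroupIsomorphism α
      involutive     : ∀ g → α (α g) ≡ g
      nonIdentity    : ∃[ g ] α g ≢ g

  Sub : Set₁
  Sub = Pred (Fin n) 0ℓ

  ω : (Fin n → Fin n) → Sub
  ω α x = ∃[ g ] x ≡ α (g ⁻¹) ∙ g

  image : (Fin n → Fin n) → Sub → Sub
  image f A x = ∃[ a ] (A a × x ≡ f a)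

  inverses : Sub → Sub
  inverses A x = ∃[ a ] (A a × x ≡ a ⁻¹)

  _·_ : Sub → Sub → Sub
  (A · B) x = ∃[ a ] ∃[ b ] (A a × B b × x ≡ a ∙ b)

  _·ʳ_ : Sub → Fin n → Sub
  (A ·ʳ s) x = ∃[ a ] (A a × x ≡ a ∙ s)

  ⟦_⟧ : Subset n → Sub
  ⟦ X ⟧ x = x ∈ X

  listed : ∀ {r} → (Fin r → Fin n) → Sub
  listed s x = ∃[ i ] s i ≡ x

  record IsGenCayleySubset (α : Fin n → Fin n) (S : Sub) : Set where
    field
      disjointω : ∀ x → S x → ¬ ω α x
      αS≡S⁻¹    : ∀ x → (image α S x → inverses S x) × (inverses S x → image α S x)

  Adj : (Fin n → Fin n) → Sub → Fin n → Fin n → Set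
  Adj α S g h = S (α (g ⁻¹) ∙ h) ⊎ S (α (h ⁻¹) ∙ g)

  record IsPerfectCode (α : Fin n → Fin n) (S : Sub) (C : Sub) : Set where
    field
      independent : ∀ x y → C x → C y → ¬ Adj α S x y
      uniqueNbr   : ∀ v → ¬ C v →
                    ∃[ c ] (C c × Adj α S v c × (∀ c′ → C c′ → Adj α S v c′ → c′ ≡ c))

  IsPartition : ∀ {m} → (Fin m → Sub) → Set
  IsPartition B = ∀ g → ∃[ j ] (B j g × (∀ k → B k g → k ≡ j))

  blocks : ∀ {r} → (Fin n → Fin n) → (Fin r → Fin n) → Sub → Fin (suc r) → Sub
  blocks α s X zero    = X
  blocks α s X (suc i) = image α X ·ʳ s i

  singletonε : Sub
  singletonε x = x ≡ ε

-- The neighbours of a vertex c of GC(G,S,α) are exactly the elements α(c)sᵢ.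
-- Hence X is a perfect code iff the sets X, α(X)s₁, …, α(X)sᵣ are pairwise
-- disjoint (independence of X and uniqueness of the neighbour in X) and cover G
-- (existence of that neighbour), which is (ii). Each of these r + 1 sets has |X|
-- elements, so once they are disjoint, covering G amounts to |G| = |X|(r + 1).
-- Finally X meets α(X)sᵢ iff α(X⁻¹)X meets S, and α(X)sᵢ meets α(X)sⱼ iff
-- sᵢsⱼ⁻¹ ∈ α(X⁻¹)α(X), which for i ≠ j is an element of SS⁻¹ other than e.
module Submission where

open import Defs
open import Data.Nat using (ℕ; suc; _+_; _*_; _≤_)
open import Data.Fin using (Fin)
open import Data.Fin.Subset using (Subset; ∣_∣)
open import Data.Product using (_×_)
open import Relation.Nullary using (¬_)
open import Relation.Binary.PropositionalEquality using (_≡_)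
open import Function.Definitions using (Injective)
open import Function.Bundles using (_⇔_)

open import Level using (0ℓ)
open import Data.Nat using (zero)
open import Data.Nat.Properties using (1+n≰n; +-comm)
open import Data.Fin using (zero; suc; punchOut; remQuot; fromℕ<)
open import Data.Fin.Properties using (0≢1+n; suc-injective; punchOut-injective; injective⇒≤; any?; _≟_; *↔×)
open import Data.Fin.Permutation using (↔⇒≡)
open import Data.Fin.Subset using (_∈_; inside; outside)
open import Data.Fin.Subset.Properties using (_∈?_)
open import Data.Vec using (_∷_; here; there)
open import Data.Product using (∃-syntax; _,_; proj₁; proj₂; map₂)
open import Data.Sum using (inj₂; [_,_])
open import Data.Empty using (⊥-elim)
open import Relation.Nullary using (yes; no; contradiction)
open import Relation.Binary.PropositionalEquality using (refl; sym; trans; cong; cong₂; subst; _≢_; module ≡-Reasoning)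
open import Function.Base using (id; _∘_)
open import Function.Definitions using (StrictlySurjective)
open import Function.Bundles using (Equivalence; Injection; mk⇔; mk⤖; _↔_)
open import Function.Consequences.Propositional using (strictlySurjective⇒surjective)
open import Function.Properties.Bijection using (⤖⇒↔)
open import Function.Properties.Inverse using (↔⇒↣)
open import Function.Construct.Composition using (_↔-∘_; _⇔-∘_)
open import Function.Construct.Symmetry using (⇔-sym)
open import Algebra.Bundles using (Group)
open import Algebra.Structures using (IsGroup)
open import Algebra.Morphism.Structures using (module GroupMorphisms)
import Algebra.Properties.Group as GroupProperties
import Relation.Binary.Reasoning.Setoid as SetoidReasoning

open Equivalence using (to; from)

enumerate : ∀ {n} (p : Subset n) → Fin ∣ p ∣ → Fin n
enumerate (inside  ∷ p) zero    = zero
enumerate (inside  ∷ p) (suc i) = suc (enumerate p i)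
enumerate (outside ∷ p) i       = suc (enumerate p i)

enumerate-∈ : ∀ {n} (p : Subset n) i → enumerate p i ∈ p
enumerate-∈ (inside  ∷ p) zero    = here
enumerate-∈ (inside  ∷ p) (suc i) = there (enumerate-∈ p i)
enumerate-∈ (outside ∷ p) i       = there (enumerate-∈ p i)

enumerate-injective : ∀ {n} (p : Subset n) → Injective _≡_ _≡_ (enumerate p)
enumerate-injective (inside  ∷ p) {zero}  {zero}  _  = refl
enumerate-injective (inside  ∷ p) {suc i} {suc j} eq = cong suc (enumerate-injective p (suc-injective eq))
enumerate-injective (outside ∷ p)                 eq = enumerate-injective p (suc-injective eq)

enumerate-onto : ∀ {n} (p : Subset n) {x} → x ∈ p → ∃[ i ] enumerate p i ≡ x
enumerate-onto (inside  ∷ p) here        = zero , refl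
enumerate-onto (inside  ∷ p) (there x∈p) = let i , eq = enumerate-onto p x∈p in suc i , cong suc eq
enumerate-onto (outside ∷ p) (there x∈p) = let i , eq = enumerate-onto p x∈p in i , cong suc eq

injective⇒surjective : ∀ {m n} {f : Fin m → Fin n} → m ≡ n →
                       Injective _≡_ _≡_ f → StrictlySurjective _≡_ f
injective⇒surjective {zero} refl _ ()
injective⇒surjective {suc m} {f = f} refl f-injective y with any? (λ x → f x ≟ y)
... | yes hit = hit
... | no ¬hit = contradiction (injective⇒≤ punchOut-injective′) 1+n≰n
  where
  y≢f : ∀ x → y ≢ f x
  y≢f x y≡fx = ¬hit (x , sym y≡fx)

  punchOut-injective′ : Injective _≡_ _≡_ (λ x → punchOut (y≢f x))
  punchOut-injective′ eq = f-injective (punchOut-injective (y≢f _) (y≢f _) eq)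

module _ {m n : ℕ} (φ : Fin m → Fin n → Fin n) (X : Subset n) where

  DisjointImages : Set
  DisjointImages = ∀ {j j′ x x′} → x ∈ X → x′ ∈ X → φ j x ≡ φ j′ x′ → j ≡ j′

  CoveringImages : Set
  CoveringImages = ∀ y → ∃[ j ] ∃[ x ] (x ∈ X × y ≡ φ j x)

  module _ (φ-injective : ∀ j → Injective _≡_ _≡_ (φ j)) where

    disjointImages-injective : DisjointImages → ∀ {j j′ x x′} → x ∈ X → x′ ∈ X →
                               φ j x ≡ φ j′ x′ → j ≡ j′ × x ≡ x′
    disjointImages-injective disjoint {j} x∈X x′∈X eq with disjoint x∈X x′∈X eq
    ... | refl = refl , φ-injective j eq

    private
      imageOf : Fin ∣ X ∣ × Fin m → Fin n
      imageOf (i , j) = φ j (enumerate X i)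

      imageOf-injective : DisjointImages → Injective _≡_ _≡_ imageOf
      imageOf-injective disjoint {i , j} {i′ , _} eq
        with refl , eq′ ← disjointImages-injective disjoint (enumerate-∈ X i) (enumerate-∈ X i′) eq
        = cong (_, j) (enumerate-injective X eq′)

    disjoint∧covering⇒count : DisjointImages → CoveringImages → n ≡ ∣ X ∣ * m
    disjoint∧covering⇒count disjoint covering = sym (↔⇒≡ (imageOf↔ ↔-∘ *↔×))
      where
      imageOf-onto : StrictlySurjective _≡_ imageOf
      imageOf-onto y with j , x , x∈X , y≡φjx ← covering y
                     with i , refl ← enumerate-onto X x∈X
        = (i , j) , sym y≡φjx

      imageOf↔ : (Fin ∣ X ∣ × Fin m) ↔ Fin n
      imageOf↔ = ⤖⇒↔ (mk⤖ (imageOf-injective disjoint , strictlySurjective⇒surjective imageOf-onto))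

    disjoint∧count⇒covering : DisjointImages → n ≡ ∣ X ∣ * m → CoveringImages
    disjoint∧count⇒covering disjoint count y =
      let t , imageOf[t]≡y = injective⇒surjective (sym count) imageOf∘remQuot-injective y
          i , j           = remQuot m t
      in  j , enumerate X i , enumerate-∈ X i , sym imageOf[t]≡y
      where
      imageOf∘remQuot-injective : Injective _≡_ _≡_ (imageOf ∘ remQuot {∣ X ∣} m)
      imageOf∘remQuot-injective = Injection.injective (↔⇒↣ *↔×) ∘ imageOf-injective disjoint

module _ {a ℓ} (G : Group a ℓ) where
  open Group G using (_≈_; _∙_; _⁻¹; setoid; assoc; ∙-congˡ; ∙-congʳ) renaming (sym to ≈-sym; trans to ≈-trans)
  open GroupProperties G using (\\-leftDividesˡ; \\-leftDividesʳ; //-rightDividesˡ; y≈x\\z; x≈z//y)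
  open SetoidReasoning setoid

  x≈a∙b⇔a⁻¹∙x≈b : ∀ {x a b} → x ≈ a ∙ b ⇔ a ⁻¹ ∙ x ≈ b
  x≈a∙b⇔a⁻¹∙x≈b {x} {a} {b} = mk⇔
    (λ x≈a∙b → ≈-sym (y≈x\\z a b x (≈-sym x≈a∙b)))
    (λ a⁻¹∙x≈b → ≈-trans (≈-sym (\\-leftDividesˡ a x)) (∙-congˡ a⁻¹∙x≈b))

  a∙b≈c∙d⇔a⁻¹∙c≈b∙d⁻¹ : ∀ {a b c d} → a ∙ b ≈ c ∙ d ⇔ a ⁻¹ ∙ c ≈ b ∙ d ⁻¹
  a∙b≈c∙d⇔a⁻¹∙c≈b∙d⁻¹ {a} {b} {c} {d} = mk⇔ forward backward
    where
    forward : a ∙ b ≈ c ∙ d → a ⁻¹ ∙ c ≈ b ∙ d ⁻¹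
    forward a∙b≈c∙d = x≈z//y (a ⁻¹ ∙ c) d b (begin
      a ⁻¹ ∙ c ∙ d    ≈⟨ assoc (a ⁻¹) c d ⟩
      a ⁻¹ ∙ (c ∙ d)  ≈⟨ ∙-congˡ a∙b≈c∙d ⟨
      a ⁻¹ ∙ (a ∙ b)  ≈⟨ \\-leftDividesʳ a b ⟩
      b               ∎)

    backward : a ⁻¹ ∙ c ≈ b ∙ d ⁻¹ → a ∙ b ≈ c ∙ d
    backward a⁻¹∙c≈b∙d⁻¹ = begin
      a ∙ b                ≈⟨ ∙-congˡ (//-rightDividesˡ d b) ⟨
      a ∙ (b ∙ d ⁻¹ ∙ d)   ≈⟨ ∙-congˡ (∙-congʳ a⁻¹∙c≈b∙d⁻¹) ⟨
      a ∙ (a ⁻¹ ∙ c ∙ d)   ≈⟨ ∙-congˡ (assoc (a ⁻¹) c d) ⟩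
      a ∙ (a ⁻¹ ∙ (c ∙ d)) ≈⟨ \\-leftDividesˡ a (c ∙ d) ⟩
      c ∙ d                ∎

module InvolutoryAutomorphism {n} {G : FinGroup n} {α : Fin n → Fin n}
                              (α-invol : IsInvolutoryAutomorphism G α) where
  open FinGroup G
  open IsInvolutoryAutomorphism α-invol using (isAutomorphism; involutive)

  group : Group 0ℓ 0ℓ
  group = record { isGroup = isGroup }

  open GroupProperties group public using (⁻¹-involutive; ⁻¹-anti-homo-∙; ∙-cancelˡ; ∙-cancelʳ; x∙y⁻¹≈ε⇒x≈y)
  open GroupMorphisms.IsGroupIsomorphism isAutomorphism public
    using () renaming (∙-homo to α-∙-homo; ⁻¹-homo to α-⁻¹-homo; injective to α-injective)

  v≡αc∙t⇔α[c⁻¹]v≡t : ∀ {v c t} → v ≡ α c ∙ t ⇔ α (c ⁻¹) ∙ v ≡ t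
  v≡αc∙t⇔α[c⁻¹]v≡t {c = c} rewrite α-⁻¹-homo c = x≈a∙b⇔a⁻¹∙x≈b group

  αx∙t≡αy∙u⇔α[x⁻¹]αy≡tu⁻¹ : ∀ {x y t u} → α x ∙ t ≡ α y ∙ u ⇔ α (x ⁻¹) ∙ α y ≡ t ∙ u ⁻¹
  αx∙t≡αy∙u⇔α[x⁻¹]αy≡tu⁻¹ {x} rewrite α-⁻¹-homo x = a∙b≈c∙d⇔a⁻¹∙c≈b∙d⁻¹ group

module Adjacency {n} {G : FinGroup n} {α : Fin n → Fin n} (α-invol : IsInvolutoryAutomorphism G α)
                 (S : Sub G) (αS⊆S⁻¹ : ∀ x → image G α S x → inverses G S x) where
  open FinGroup G
  open IsInvolutoryAutomorphism α-invol using (involutive)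
  open InvolutoryAutomorphism α-invol

  α⁻¹-closed : ∀ {t} → S t → S (α t ⁻¹)
  α⁻¹-closed {t} t∈S with u , u∈S , αt≡u⁻¹ ← αS⊆S⁻¹ (α t) (t , t∈S , refl) =
    subst S (sym (trans (cong _⁻¹ αt≡u⁻¹) (⁻¹-involutive u))) u∈S

  edge-reverse : ∀ {g h} → S (α (g ⁻¹) ∙ h) → S (α (h ⁻¹) ∙ g)
  edge-reverse {g} {h} = subst S α[α[g⁻¹]h]⁻¹≡α[h⁻¹]g ∘ α⁻¹-closed
    where
    open ≡-Reasoning
    α[α[g⁻¹]h]⁻¹≡α[h⁻¹]g : α (α (g ⁻¹) ∙ h) ⁻¹ ≡ α (h ⁻¹) ∙ g
    α[α[g⁻¹]h]⁻¹≡α[h⁻¹]g = begin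
      α (α (g ⁻¹) ∙ h) ⁻¹      ≡⟨ cong _⁻¹ (α-∙-homo (α (g ⁻¹)) h) ⟩
      (α (α (g ⁻¹)) ∙ α h) ⁻¹  ≡⟨ cong (λ z → (z ∙ α h) ⁻¹) (involutive (g ⁻¹)) ⟩
      (g ⁻¹ ∙ α h) ⁻¹          ≡⟨ ⁻¹-anti-homo-∙ (g ⁻¹) (α h) ⟩
      α h ⁻¹ ∙ g ⁻¹ ⁻¹         ≡⟨ cong₂ _∙_ (sym (α-⁻¹-homo h)) (⁻¹-involutive g) ⟩
      α (h ⁻¹) ∙ g             ∎

  Adj⇔α[c⁻¹]v∈S : ∀ {v c} → Adj G α S v c ⇔ S (α (c ⁻¹) ∙ v)
  Adj⇔α[c⁻¹]v∈S = mk⇔ [ edge-reverse , id ] inj₂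

module PerfectCode {n} (G : FinGroup n) {α : Fin n → Fin n} (α-invol : IsInvolutoryAutomorphism G α)
                   {r} (s : Fin r → Fin n) (s-injective : Injective _≡_ _≡_ s)
                   (αS⊆S⁻¹ : ∀ x → image G α (listed G s) x → inverses G (listed G s) x)
                   (X : Subset n) where
  open FinGroup G
  open IsGroup isGroup using (inverseˡ; inverseʳ)
  open InvolutoryAutomorphism α-invol
  open Adjacency α-invol (listed G s) αS⊆S⁻¹

  S : Sub G
  S = listed G s

  ⟦X⟧ : Sub G
  ⟦X⟧ = ⟦_⟧ G X

  block : Fin (suc r) → Sub G
  block = blocks G α s ⟦X⟧

  blockMap : Fin (suc r) → Fin n → Fin n
  blockMap zero    x = x
  blockMap (suc i) x = α x ∙ s i

  blockMap-injective : ∀ j → Injective _≡_ _≡_ (blockMap j)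
  blockMap-injective zero    eq = eq
  blockMap-injective (suc i) eq = α-injective (∙-cancelʳ (s i) _ _ eq)

  blocks⇔image : ∀ j {y} → block j y ⇔ image G (blockMap j) ⟦X⟧ y
  blocks⇔image zero    = mk⇔ (λ y∈X → _ , y∈X , refl) (λ { (_ , x∈X , refl) → x∈X })
  blocks⇔image (suc i) = mk⇔ (λ { (_ , (x , x∈X , refl) , refl) → x , x∈X , refl })
                             (λ { (x , x∈X , refl) → α x , (x , x∈X , refl) , refl })

  Adj⇔blockMap : ∀ {v c} → Adj G α S v c ⇔ (∃[ i ] v ≡ blockMap (suc i) c)
  Adj⇔blockMap = mk⇔ (λ adj → map₂ (λ si≡ → from v≡αc∙t⇔α[c⁻¹]v≡t (sym si≡)) (to Adj⇔α[c⁻¹]v∈S adj))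
                     (λ (i , v≡) → from Adj⇔α[c⁻¹]v∈S (i , sym (to v≡αc∙t⇔α[c⁻¹]v≡t v≡)))

  Disjoint : Set
  Disjoint = DisjointImages blockMap X

  Covering : Set
  Covering = CoveringImages blockMap X

  partition⇔disjoint×covering : IsPartition G block ⇔ (Disjoint × Covering)
  partition⇔disjoint×covering = mk⇔ split merge
    where
    split : IsPartition G block → Disjoint × Covering
    split partition = disjoint , covering
      where
      disjoint : Disjoint
      disjoint {j} {j′} {x} x∈X x′∈X eq =
        let _ , _ , unique = partition (blockMap j x)
        in  trans (unique j (from (blocks⇔image j) (x , x∈X , refl)))
                  (sym (unique j′ (from (blocks⇔image j′) (_ , x′∈X , eq))))

      covering : Covering
      covering y = let j , y∈Bj , _ = partition y in j , to (blocks⇔image j) y∈Bj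

    merge : Disjoint × Covering → IsPartition G block
    merge (disjoint , covering) y =
      let j , x , x∈X , y≡ = covering y
      in  j , from (blocks⇔image j) (x , x∈X , y≡) ,
          λ k y∈Bk → let _ , x′∈X , y≡′ = to (blocks⇔image k) y∈Bk
                     in  disjoint x′∈X x∈X (trans (sym y≡′) y≡)

  module _ (perfect : IsPerfectCode G α S ⟦X⟧) where
    open IsPerfectCode perfect

    perfectCode⇒neighbour-unique : ∀ {v x x′} → x ∈ X → x′ ∈ X →
                                   Adj G α S v x → Adj G α S v x′ → x ≡ x′
    perfectCode⇒neighbour-unique {v} {x} {x′} x∈X x′∈X adj adj′ with v ∈? X
    ... | yes v∈X = ⊥-elim (independent v x v∈X x∈X adj)
    ... | no  v∉X = let _ , _ , _ , unique = uniqueNbr v v∉X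
                    in  trans (unique x x∈X adj) (sym (unique x′ x′∈X adj′))

    perfectCode⇒disjoint : Disjoint
    perfectCode⇒disjoint {zero}  {zero}  _ _ _ = refl
    perfectCode⇒disjoint {zero}  {suc i} {x} {x′} x∈X x′∈X eq =
      ⊥-elim (independent x x′ x∈X x′∈X (from Adj⇔blockMap (i , eq)))
    perfectCode⇒disjoint {suc i} {zero}  {x} {x′} x∈X x′∈X eq =
      ⊥-elim (independent x′ x x′∈X x∈X (from Adj⇔blockMap (i , sym eq)))
    perfectCode⇒disjoint {suc i} {suc i′} {x} x∈X x′∈X eq
      with refl ← perfectCode⇒neighbour-unique x∈X x′∈X (from Adj⇔blockMap (i , refl))
                                                        (from Adj⇔blockMap (i′ , eq))
      = cong suc (s-injective (∙-cancelˡ (α x) _ _ eq))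

    perfectCode⇒covering : Covering
    perfectCode⇒covering v with v ∈? X
    ... | yes v∈X = zero , v , v∈X , refl
    ... | no  v∉X = let c , c∈X , adj , _ = uniqueNbr v v∉X
                        i , v≡           = to Adj⇔blockMap adj
                    in  suc i , c , c∈X , v≡

    perfectCode⇒disjoint×covering : Disjoint × Covering
    perfectCode⇒disjoint×covering = perfectCode⇒disjoint , perfectCode⇒covering

  disjoint×covering⇒perfectCode : Disjoint × Covering → IsPerfectCode G α S ⟦X⟧
  disjoint×covering⇒perfectCode (disjoint , covering) = record
    { independent = λ x y x∈X y∈X adj →
        let i , x≡ = to Adj⇔blockMap adj in 0≢1+n (disjoint {zero} {suc i} x∈X y∈X x≡)
    ; uniqueNbr = uniqueNbr
    }
    where
    uniqueNbr : ∀ v → ¬ v ∈ X → ∃[ c ] (c ∈ X × Adj G α S v c ×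
                                        (∀ c′ → c′ ∈ X → Adj G α S v c′ → c′ ≡ c))
    uniqueNbr v v∉X with covering v
    ... | zero  , _ , x∈X , refl = ⊥-elim (v∉X x∈X)
    ... | suc i , c , c∈X , v≡   = c , c∈X , from Adj⇔blockMap (i , v≡) , λ c′ c′∈X adj′ →
      let _ , v≡′ = to Adj⇔blockMap adj′
      in  proj₂ (disjointImages-injective blockMap X blockMap-injective disjoint
                                          c′∈X c∈X (trans (sym v≡′) v≡))

  perfectCode⇔partition : IsPerfectCode G α S ⟦X⟧ ⇔ IsPartition G block
  perfectCode⇔partition = ⇔-sym partition⇔disjoint×covering ⇔-∘
    mk⇔ perfectCode⇒disjoint×covering disjoint×covering⇒perfectCode

  α[X⁻¹]X∩S≡∅ : Set
  α[X⁻¹]X∩S≡∅ = ∀ x → (_·_ G (image G α (inverses G ⟦X⟧)) ⟦X⟧) x → ¬ S x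

  α[X⁻¹]αX : Sub G
  α[X⁻¹]αX = _·_ G (image G α (inverses G ⟦X⟧)) (image G α ⟦X⟧)

  SS⁻¹ : Sub G
  SS⁻¹ = _·_ G S (inverses G S)

  α[X⁻¹]αX∩SS⁻¹⊆｛ε｝ : Set
  α[X⁻¹]αX∩SS⁻¹⊆｛ε｝ = ∀ x → α[X⁻¹]αX x × SS⁻¹ x → x ≡ ε

  α[X⁻¹]αX∩SS⁻¹≡｛ε｝ : Set
  α[X⁻¹]αX∩SS⁻¹≡｛ε｝ = ∀ x → (α[X⁻¹]αX x × SS⁻¹ x) ⇔ singletonε G x

  α[A⁻¹]B-intro : ∀ {A B : Sub G} {a b} → A a → B b →
                  _·_ G (image G α (inverses G A)) B (α (a ⁻¹) ∙ b)
  α[A⁻¹]B-intro a∈A b∈B = _ , _ , (_ , (_ , a∈A , refl) , refl) , b∈B , refl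

  SS⁻¹-intro : ∀ i j → SS⁻¹ (s i ∙ s j ⁻¹)
  SS⁻¹-intro i j = _ , _ , (i , refl) , (_ , (j , refl) , refl) , refl

  disjoint⇒α[X⁻¹]X∩S≡∅ : Disjoint → α[X⁻¹]X∩S≡∅
  disjoint⇒α[X⁻¹]X∩S≡∅ disjoint _ (_ , _ , (_ , (a , a∈X , refl) , refl) , b∈X , refl) (i , si≡) =
    0≢1+n (disjoint {zero} {suc i} b∈X a∈X (from v≡αc∙t⇔α[c⁻¹]v≡t (sym si≡)))

  disjoint⇒α[X⁻¹]αX∩SS⁻¹⊆｛ε｝ : Disjoint → α[X⁻¹]αX∩SS⁻¹⊆｛ε｝
  disjoint⇒α[X⁻¹]αX∩SS⁻¹⊆｛ε｝ disjoint _
    ( (_ , _ , (_ , (a , a∈X , refl) , refl) , (b , b∈X , refl) , refl)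
    , (_ , _ , (i , refl) , (_ , (j , refl) , refl) , y≡) )
    with refl ← disjoint {suc i} {suc j} a∈X b∈X (from αx∙t≡αy∙u⇔α[x⁻¹]αy≡tu⁻¹ y≡)
    = trans y≡ (inverseʳ (s i))

  conditions⇒disjoint : α[X⁻¹]X∩S≡∅ → α[X⁻¹]αX∩SS⁻¹⊆｛ε｝ → Disjoint
  conditions⇒disjoint _ _ {zero} {zero} _ _ _ = refl
  conditions⇒disjoint ∩S≡∅ _ {zero} {suc i} x∈X x′∈X eq =
    ⊥-elim (∩S≡∅ _ (α[A⁻¹]B-intro x′∈X x∈X) (i , sym (to v≡αc∙t⇔α[c⁻¹]v≡t eq)))
  conditions⇒disjoint ∩S≡∅ _ {suc i} {zero} x∈X x′∈X eq =
    ⊥-elim (∩S≡∅ _ (α[A⁻¹]B-intro x∈X x′∈X) (i , sym (to v≡αc∙t⇔α[c⁻¹]v≡t (sym eq))))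
  conditions⇒disjoint _ ∩SS⁻¹⊆ε {suc i} {suc j} {x} {x′} x∈X x′∈X eq =
    cong suc (s-injective (x∙y⁻¹≈ε⇒x≈y (s i) (s j) (trans (sym y≡) (∩SS⁻¹⊆ε _ (y∈α[X⁻¹]αX , y∈SS⁻¹)))))
    where
    y≡ : α (x ⁻¹) ∙ α x′ ≡ s i ∙ s j ⁻¹
    y≡ = to αx∙t≡αy∙u⇔α[x⁻¹]αy≡tu⁻¹ eq

    y∈α[X⁻¹]αX : α[X⁻¹]αX (α (x ⁻¹) ∙ α x′)
    y∈α[X⁻¹]αX = α[A⁻¹]B-intro x∈X (x′ , x′∈X , refl)

    y∈SS⁻¹ : SS⁻¹ (α (x ⁻¹) ∙ α x′)
    y∈SS⁻¹ = subst SS⁻¹ (sym y≡) (SS⁻¹-intro i j)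

  ⊆｛ε｝⇒≡｛ε｝ : ∃[ x ] x ∈ X → Fin r → α[X⁻¹]αX∩SS⁻¹⊆｛ε｝ → α[X⁻¹]αX∩SS⁻¹≡｛ε｝
  ⊆｛ε｝⇒≡｛ε｝ (x , x∈X) i ∩SS⁻¹⊆ε y = mk⇔ (∩SS⁻¹⊆ε y) λ { refl → ε∈α[X⁻¹]αX , ε∈SS⁻¹ }
    where
    ε∈α[X⁻¹]αX : α[X⁻¹]αX ε
    ε∈α[X⁻¹]αX = subst α[X⁻¹]αX (trans (cong (_∙ α x) (α-⁻¹-homo x)) (inverseˡ (α x)))
                       (α[A⁻¹]B-intro x∈X (x , x∈X , refl))

    ε∈SS⁻¹ : SS⁻¹ ε
    ε∈SS⁻¹ = subst SS⁻¹ (inverseʳ (s i)) (SS⁻¹-intro i i)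

  disjoint×covering⇔conditions : Fin r →
    (Disjoint × Covering) ⇔ ((n ≡ ∣ X ∣ * (r + 1)) × α[X⁻¹]X∩S≡∅ × α[X⁻¹]αX∩SS⁻¹≡｛ε｝)
  disjoint×covering⇔conditions i = mk⇔ forward backward
    where
    forward : Disjoint × Covering → (n ≡ ∣ X ∣ * (r + 1)) × α[X⁻¹]X∩S≡∅ × α[X⁻¹]αX∩SS⁻¹≡｛ε｝
    forward (disjoint , covering) =
      trans (disjoint∧covering⇒count blockMap X blockMap-injective disjoint covering)
            (cong (∣ X ∣ *_) (+-comm 1 r)) ,
      disjoint⇒α[X⁻¹]X∩S≡∅ disjoint ,
      ⊆｛ε｝⇒≡｛ε｝ nonempty i (disjoint⇒α[X⁻¹]αX∩SS⁻¹⊆｛ε｝ disjoint)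
      where
      nonempty : ∃[ x ] x ∈ X
      nonempty = let _ , x , x∈X , _ = covering ε in x , x∈X

    backward : (n ≡ ∣ X ∣ * (r + 1)) × α[X⁻¹]X∩S≡∅ × α[X⁻¹]αX∩SS⁻¹≡｛ε｝ → Disjoint × Covering
    backward (count , ∩S≡∅ , ∩SS⁻¹≡｛ε｝) =
      disjoint ,
      disjoint∧count⇒covering blockMap X blockMap-injective disjoint
        (trans count (cong (∣ X ∣ *_) (+-comm r 1)))
      where
      disjoint : Disjoint
      disjoint = conditions⇒disjoint ∩S≡∅ (λ y → to (∩SS⁻¹≡｛ε｝ y))

  partition⇔conditions : Fin r → IsPartition G block ⇔
    ((n ≡ ∣ X ∣ * (r + 1)) × α[X⁻¹]X∩S≡∅ × α[X⁻¹]αX∩SS⁻¹≡｛ε｝)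
  partition⇔conditions i = disjoint×covering⇔conditions i ⇔-∘ partition⇔disjoint×covering

lemma2p4 : (n : ℕ) (G : FinGroup n) →
  (α : Fin n → Fin n) → IsInvolutoryAutomorphism G α →
  (r : ℕ) → 1 ≤ r → (s : Fin r → Fin n) → Injective _≡_ _≡_ s →
  IsGenCayleySubset G α (listed G s) →
  (X : Subset n) →
  (IsPerfectCode G α (listed G s) (⟦_⟧ G X)
     ⇔ IsPartition G (blocks G α s (⟦_⟧ G X)))
  × (IsPartition G (blocks G α s (⟦_⟧ G X))
     ⇔ ((n ≡ ∣ X ∣ * (r + 1))
        × (∀ x → (_·_ G (image G α (inverses G (⟦_⟧ G X))) (⟦_⟧ G X)) x → ¬ listed G s x)
        × (∀ x → ((_·_ G (image G α (inverses G (⟦_⟧ G X))) (image G α (⟦_⟧ G X)) x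
                   × _·_ G (listed G s) (inverses G (listed G s)) x)
                  ⇔ singletonε G x))))
lemma2p4 n G α α-invol r 1≤r s s-injective genCayley X =
  perfectCode⇔partition , partition⇔conditions (fromℕ< 1≤r)
  where
  αS⊆S⁻¹ : ∀ x → image G α (listed G s) x → inverses G (listed G s) x
  αS⊆S⁻¹ x = proj₁ (IsGenCayleySubset.αS≡S⁻¹ genCayley x)

  open PerfectCode G α-invol s s-injective αS⊆S⁻¹ X
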